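{- Let $0\leq\nu\leq\tau\ll 1$ and suppose that $G$ is a robust $(\nu,\tau)$-outexpander on $n$ vertices. Let $V_0$ be a set of at most $\nu^2 n$ new vertices, and let $G'$ be any digraph with vertex set $V(G)\cup V_0$ which contains $G$ as the subdigraph induced on $V(G)$. Then $G'$ is a robust $(\nu/2,2\tau)$-outexpander.
   Context: For a digraph $H$ on $N$ vertices and $S\subseteq V(H)$, $RN^+_{\nu,H}(S)$ is the set of vertices of $H$ having at least $\nu N$ inneighbours in $S$; $H$ is a robust $(\nu,\tau)$-outexpander if $|RN^+_{\nu,H}(S)|\geq|S|+\nu N$ for all $S\subseteq V(H)$ with $\tau N<|S|<(1-\tau)N$. The notation $\tau\ll1$ means $\tau$ is sufficiently small.
   Formalization: The parameters ν and τ are taken to be rational. -}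

module Defs where

open import Data.Bool using (Bool; true; false)
open import Data.Nat using (ℕ)
open import Data.Fin using (Fin; _↑ˡ_)
open import Data.Fin.Subset using (Subset; _∩_; ∣_∣)
open import Data.Vec using (tabulate)
open import Data.Integer using (+_)
open import Data.Rational using (ℚ; _/_; _*_; _+_; _-_; _≤_; _<_; _≤ᵇ_; 1ℚ)
open import Data.Product using (_×_)
open import Relation.Binary.PropositionalEquality using (_≡_)

-- A digraph on N vertices: adjacency relation (u , v) ↦ "edge u → v", loopless.
record Digraph (N : ℕ) : Set where
  field
    adj      : Fin N → Fin N → Bool
    loopless : ∀ v → adj v v ≡ false
open Digraph public

⟦_⟧ : ℕ → ℚ
⟦ k ⟧ = + k / 1

inNbrs : ∀ {N} → Digraph N → Fin N → Subset N
inNbrs H v = tabulate (λ u → adj H u v)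

RN⁺ : ∀ {N} → ℚ → Digraph N → Subset N → Subset N
RN⁺ {N} ν H S = tabulate (λ v → (ν * ⟦ N ⟧) ≤ᵇ ⟦ ∣ S ∩ inNbrs H v ∣ ⟧)

RobustOutexpander : ∀ {N} → ℚ → ℚ → Digraph N → Set
RobustOutexpander {N} ν τ H =
  ∀ (S : Subset N) → τ * ⟦ N ⟧ < ⟦ ∣ S ∣ ⟧ → ⟦ ∣ S ∣ ⟧ < (1ℚ - τ) * ⟦ N ⟧ →
    ⟦ ∣ S ∣ ⟧ + ν * ⟦ N ⟧ ≤ ⟦ ∣ RN⁺ ν H S ∣ ⟧

-- G' on V(G) ∪ V₀ (V(G) = first n vertices, V₀ = last m) contains G as
-- the subdigraph induced on V(G)
InducesOn : ∀ {n m} → Digraph (n Data.Nat.+ m) → Digraph n → Set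
InducesOn {n} {m} G' G =
  ∀ (u v : Fin n) → adj G' (u ↑ˡ m) (v ↑ˡ m) ≡ adj G u v

-- Split S ⊆ V(G) ∪ V₀ as X ∪ Y with X ⊆ V(G) and Y ⊆ V₀. As |Y| ≤ |V₀| ≤ ν²n is tiny
-- compared with τn, the bounds 2τ(n+|V₀|) < |S| < (1-2τ)(n+|V₀|) force τn < |X| < (1-τ)n,
-- so RN⁺_{ν,G}(X) has at least |X| + νn vertices. Each of them has at least
-- νn ≥ (ν/2)(n+|V₀|) inneighbours in X ⊆ S, already inside G, hence lies in
-- RN⁺_{ν/2,G'}(S); and |X| + νn ≥ |S| + (ν/2)(n+|V₀|) because
-- |Y| + (ν/2)|V₀| ≤ (1 + ν/2)ν²n ≤ (ν/2)n once ν ≤ ¼. Hence τ₀ = ¼ works.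
module Submission where

open import Defs
open import Data.Bool using (Bool; true; false; T; _∧_)
open import Data.Bool.Properties using (T-≡)
open import Data.Fin using (Fin; zero; suc; _↑ˡ_; _↑ʳ_)
open import Data.Fin.Subset using (Subset; _∩_; ∣_∣)
open import Data.Fin.Subset.Properties using (p⊆q⇒∣p∣≤∣q∣; ∣p∣≤n)
open import Data.Integer as ℤ using (+_)
import Data.Integer.Properties as ℤ
open import Data.Nat using (ℕ; suc)
import Data.Nat as ℕ
import Data.Nat.Properties as ℕ
open import Data.Nat.Coprimality using (1-coprimeTo) renaming (sym to coprime-sym)
open import Data.Product using (Σ; _×_; _,_)
open import Data.Rational hiding (∣_∣)
open import Data.Rational.Properties
open import Data.Vec using (Vec; []; _∷_; _++_; _[_]=_; tabulate; splitAt)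
open import Data.Vec.Properties
  using (tabulate-cong; lookup∘tabulate; zipWith-++; []=⇒lookup; lookup⇒[]=)
open import Function using (_∘_; Equivalence)
open import Relation.Binary.PropositionalEquality as ≡
  using (_≡_; refl; sym; trans; cong; cong₂; subst; subst₂)
open import Relation.Nullary.Decidable using (dec⇒maybe)
open import Tactic.RingSolver using (solve-∀)
open import Tactic.RingSolver.Core.AlmostCommutativeRing
  using (AlmostCommutativeRing; fromCommutativeRing)

ℚ-ring : AlmostCommutativeRing _ _
ℚ-ring = fromCommutativeRing +-*-commutativeRing (λ p → dec⇒maybe (0ℚ ≟ p))

¼ ¾ : ℚ
¼ = + 1 / 4
¾ = + 3 / 4

private
  variable
    p q : ℚ

≤-by-difference : ∀ {p d q} → p + d ≡ q → 0ℚ ≤ d → p ≤ q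
≤-by-difference {p} {d} refl 0≤d = subst₂ _≤_ (+-identityʳ p) refl (+-monoʳ-≤ p 0≤d)

<-by-difference : ∀ {p d q} → p + d ≡ q → 0ℚ < d → p < q
<-by-difference {p} {d} refl 0<d = subst₂ _<_ (+-identityʳ p) refl (+-monoʳ-< p 0<d)

p≤q⇒0≤q-p : p ≤ q → 0ℚ ≤ q - p
p≤q⇒0≤q-p {p} p≤q = subst₂ _≤_ (+-inverseʳ p) refl (+-monoˡ-≤ (- p) p≤q)

p<q⇒0<q-p : p < q → 0ℚ < q - p
p<q⇒0<q-p {p} p<q = subst₂ _<_ (+-inverseʳ p) refl (+-monoˡ-< (- p) p<q)

0≤p+q : 0ℚ ≤ p → 0ℚ ≤ q → 0ℚ ≤ p + q
0≤p+q = +-mono-≤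

0<p+q : 0ℚ < p → 0ℚ ≤ q → 0ℚ < p + q
0<p+q = +-mono-<-≤

0≤-by-computation : ∀ c → T (0ℚ ≤ᵇ c) → 0ℚ ≤ c
0≤-by-computation c = ≤ᵇ⇒≤

0≤p*q : 0ℚ ≤ p → 0ℚ ≤ q → 0ℚ ≤ p * q
0≤p*q {p} {q} 0≤p 0≤q =
  nonNegative⁻¹ (p * q) {{nonNeg*nonNeg⇒nonNeg p {{nonNegative 0≤p}} q {{nonNegative 0≤q}}}}

⟦⟧≡mkℚ : ∀ k → ⟦ k ⟧ ≡ mkℚ (+ k) 0 (coprime-sym (1-coprimeTo k))
⟦⟧≡mkℚ k = normalize-coprime (coprime-sym (1-coprimeTo k))

⟦⟧-+ : ∀ a b → ⟦ a ℕ.+ b ⟧ ≡ ⟦ a ⟧ + ⟦ b ⟧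
⟦⟧-+ a b = begin
  ⟦ a ℕ.+ b ⟧
    ≡⟨ cong₂ (λ x y → (x ℤ.+ y) / 1) (ℤ.*-identityʳ (+ a)) (ℤ.*-identityʳ (+ b)) ⟨
  (+ a ℤ.* + 1 ℤ.+ + b ℤ.* + 1) / 1
    ≡⟨ cong₂ _+_ (⟦⟧≡mkℚ a) (⟦⟧≡mkℚ b) ⟨
  ⟦ a ⟧ + ⟦ b ⟧
    ∎
  where open ≡.≡-Reasoning

⟦⟧-mono : ∀ {a b} → a ℕ.≤ b → ⟦ a ⟧ ≤ ⟦ b ⟧
⟦⟧-mono {a} {b} a≤b = subst₂ _≤_ (sym (⟦⟧≡mkℚ a)) (sym (⟦⟧≡mkℚ b))
  (*≤* (subst₂ ℤ._≤_ (sym (ℤ.*-identityʳ (+ a))) (sym (ℤ.*-identityʳ (+ b))) (ℤ.+≤+ a≤b)))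

0≤⟦⟧ : ∀ k → 0ℚ ≤ ⟦ k ⟧
0≤⟦⟧ k = ⟦⟧-mono {0} {k} ℕ.z≤n

-- N = |V(G)|, M = |V₀|. Each inequality holds because the difference of its sides is an
-- explicit sum of products of nonnegative terms; the ring solver checks that identity.
module FewNewVertices {ν τ N M : ℚ} (0≤ν : 0ℚ ≤ ν) (ν≤τ : ν ≤ τ) (τ≤¼ : τ ≤ ¼) (0≤N : 0ℚ ≤ N)
         (M≤ν²N : M ≤ ν * ν * N) where

  private
    0≤τ : 0ℚ ≤ τ
    0≤τ = ≤-trans 0≤ν ν≤τ

    0≤¼-τ : 0ℚ ≤ ¼ - τ
    0≤¼-τ = p≤q⇒0≤q-p τ≤¼

    0≤τ-ν : 0ℚ ≤ τ - ν
    0≤τ-ν = p≤q⇒0≤q-p ν≤τ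

    0≤ν²N-M : 0ℚ ≤ ν * ν * N - M
    0≤ν²N-M = p≤q⇒0≤q-p M≤ν²N

    0≤ν½ : 0ℚ ≤ ν * ½
    0≤ν½ = 0≤p*q 0≤ν (0≤-by-computation ½ _)

  M≤τN : M ≤ τ * N
  M≤τN = ≤-by-difference (identity ν τ N M)
    (0≤p+q (0≤p+q 0≤ν²N-M (0≤p*q 0≤τ-ν 0≤N))
           (0≤p*q (0≤p*q 0≤ν (0≤p+q (0≤p+q (0≤-by-computation ¾ _) 0≤¼-τ) 0≤τ-ν)) 0≤N))
    where
    identity : ∀ ν τ N M →
      M + ((ν * ν * N - M + (τ - ν) * N) + ν * (¾ + (¼ - τ) + (τ - ν)) * N) ≡ τ * N
    identity = solve-∀ ℚ-ring

  M+ν½M≤ν½N : M + ν * ½ * M ≤ ν * ½ * N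
  M+ν½M≤ν½N = ≤-by-difference (identity ν τ N M)
    (0≤p+q (0≤p*q (0≤p+q (0≤-by-computation 1ℚ _) 0≤ν½) 0≤ν²N-M)
           (0≤p*q (0≤p*q 0≤ν 0≤N)
                  (0≤p+q (0≤-by-computation (+ 7 / 32) _)
                         (0≤p*q (0≤p+q 0≤¼-τ 0≤τ-ν) (0≤p+q (0≤-by-computation (+ 9 / 8) _) 0≤ν½)))))
    where
    identity : ∀ ν τ N M →
      M + ν * ½ * M
        + ((1ℚ + ν * ½) * (ν * ν * N - M) + ν * N * (+ 7 / 32 + (¼ - τ + (τ - ν)) * (+ 9 / 8 + ν * ½)))
      ≡ ν * ½ * N
    identity = solve-∀ ℚ-ring

  ν½[N+M]≤νN : ν * ½ * (N + M) ≤ ν * N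
  ν½[N+M]≤νN = ≤-by-difference (identity ν τ N M)
    (0≤p*q 0≤ν½ (0≤p+q (p≤q⇒0≤q-p M≤τN) (0≤p*q (0≤p+q (0≤-by-computation ¾ _) 0≤¼-τ) 0≤N)))
    where
    identity : ∀ ν τ N M → ν * ½ * (N + M) + ν * ½ * ((τ * N - M) + (¾ + (¼ - τ)) * N) ≡ ν * N
    identity = solve-∀ ℚ-ring

  module _ (a : ℚ) {b : ℚ} (0≤b : 0ℚ ≤ b) (b≤M : b ≤ M) where

    private
      0≤2τM : 0ℚ ≤ ⟦ 2 ⟧ * τ * M
      0≤2τM = 0≤p*q (0≤p*q (0≤-by-computation ⟦ 2 ⟧ _) 0≤τ) (≤-trans 0≤b b≤M)

      0≤M-b : 0ℚ ≤ M - b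
      0≤M-b = p≤q⇒0≤q-p b≤M

    2τ[N+M]<a+b⇒τN<a : ⟦ 2 ⟧ * τ * (N + M) < a + b → τ * N < a
    2τ[N+M]<a+b⇒τN<a lower = <-by-difference (identity τ N M a b)
      (0<p+q (p<q⇒0<q-p lower) (0≤p+q 0≤M-b (0≤p+q (p≤q⇒0≤q-p M≤τN) 0≤2τM)))
      where
      identity : ∀ τ N M a b →
        τ * N + ((a + b - ⟦ 2 ⟧ * τ * (N + M)) + ((M - b) + ((τ * N - M) + ⟦ 2 ⟧ * τ * M))) ≡ a
      identity = solve-∀ ℚ-ring

    a+b<[1-2τ][N+M]⇒a<[1-τ]N : a + b < (1ℚ - ⟦ 2 ⟧ * τ) * (N + M) → a < (1ℚ - τ) * N
    a+b<[1-2τ][N+M]⇒a<[1-τ]N upper = <-by-difference (identity τ N M a b)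
      (0<p+q (p<q⇒0<q-p upper) (0≤p+q 0≤b (0≤p+q (p≤q⇒0≤q-p M≤τN) 0≤2τM)))
      where
      identity : ∀ τ N M a b →
        a + (((1ℚ - ⟦ 2 ⟧ * τ) * (N + M) - (a + b)) + (b + ((τ * N - M) + ⟦ 2 ⟧ * τ * M)))
        ≡ (1ℚ - τ) * N
      identity = solve-∀ ℚ-ring

    a+b+ν½[N+M]≤a+νN : a + b + ν * ½ * (N + M) ≤ a + ν * N
    a+b+ν½[N+M]≤a+νN = ≤-by-difference (identity ν N M a b) (0≤p+q 0≤M-b (p≤q⇒0≤q-p M+ν½M≤ν½N))
      where
      identity : ∀ ν N M a b →
        a + b + ν * ½ * (N + M) + ((M - b) + (ν * ½ * N - (M + ν * ½ * M))) ≡ a + ν * N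
      identity = solve-∀ ℚ-ring

tabulate-++ : ∀ {A : Set} n {m} (f : Fin (n ℕ.+ m) → A) →
              tabulate f ≡ tabulate (f ∘ (_↑ˡ m)) ++ tabulate (f ∘ (n ↑ʳ_))
tabulate-++ ℕ.zero    f = refl
tabulate-++ (suc n) f = cong (f zero ∷_) (tabulate-++ n (f ∘ suc))

∣p++q∣≡∣p∣+∣q∣ : ∀ {n m} (p : Subset n) (q : Subset m) → ∣ p ++ q ∣ ≡ ∣ p ∣ ℕ.+ ∣ q ∣
∣p++q∣≡∣p∣+∣q∣ []          q = refl
∣p++q∣≡∣p∣+∣q∣ (true ∷ p)  q = cong suc (∣p++q∣≡∣p∣+∣q∣ p q)
∣p++q∣≡∣p∣+∣q∣ (false ∷ p) q = ∣p++q∣≡∣p∣+∣q∣ p q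

∣p∣≤∣p++q∣ : ∀ {n m} (p : Subset n) (q : Subset m) → ∣ p ∣ ℕ.≤ ∣ p ++ q ∣
∣p∣≤∣p++q∣ p q = ℕ.≤-trans (ℕ.m≤m+n ∣ p ∣ ∣ q ∣) (ℕ.≤-reflexive (sym (∣p++q∣≡∣p∣+∣q∣ p q)))

∣tabulate∣-mono : ∀ {n} {f g : Fin n → Bool} → (∀ i → T (f i) → T (g i)) →
                  ∣ tabulate f ∣ ℕ.≤ ∣ tabulate g ∣
∣tabulate∣-mono {f = f} {g} f⇒g = p⊆q⇒∣p∣≤∣q∣ {p = tabulate f} {tabulate g} λ {i} i∈f →
  lookup⇒[]= i _ (trans (lookup∘tabulate g i) (Equivalence.to T-≡ (f⇒g i (T-f i i∈f))))
  where
  T-f : ∀ i → tabulate f [ i ]= true → T (f i)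
  T-f i i∈f = Equivalence.from T-≡ (trans (sym (lookup∘tabulate f i)) ([]=⇒lookup i∈f))

∣tabulate∘↑ˡ∣≤∣tabulate∣ : ∀ n {m} (f : Fin (n ℕ.+ m) → Bool) →
                           ∣ tabulate (f ∘ (_↑ˡ m)) ∣ ℕ.≤ ∣ tabulate f ∣
∣tabulate∘↑ˡ∣≤∣tabulate∣ n {m} f = ℕ.≤-trans
  (∣p∣≤∣p++q∣ (tabulate (f ∘ (_↑ˡ m))) (tabulate (f ∘ (n ↑ʳ_))))
  (ℕ.≤-reflexive (cong ∣_∣ (sym (tabulate-++ n f))))

⟦∣p++q∣⟧ : ∀ {n m} (p : Subset n) (q : Subset m) → ⟦ ∣ p ++ q ∣ ⟧ ≡ ⟦ ∣ p ∣ ⟧ + ⟦ ∣ q ∣ ⟧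
⟦∣p++q∣⟧ p q = trans (cong ⟦_⟧ (∣p++q∣≡∣p∣+∣q∣ p q)) (⟦⟧-+ ∣ p ∣ ∣ q ∣)

module _ {n m} {G : Digraph n} {G' : Digraph (n ℕ.+ m)} (G'-ind : InducesOn G' G) where

  inNbrs-V₀ : Fin n → Subset m
  inNbrs-V₀ v = tabulate (λ u → adj G' (n ↑ʳ u) (v ↑ˡ m))

  inNbrs-↑ˡ : ∀ v → inNbrs G' (v ↑ˡ m) ≡ inNbrs G v ++ inNbrs-V₀ v
  inNbrs-↑ˡ v = trans (tabulate-++ n (λ u → adj G' u (v ↑ˡ m)))
                      (cong (_++ inNbrs-V₀ v) (tabulate-cong (λ u → G'-ind u v)))

  ∣∩inNbrs∣-↑ˡ : ∀ (X : Subset n) (Y : Subset m) v →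
                 ∣ X ∩ inNbrs G v ∣ ℕ.≤ ∣ (X ++ Y) ∩ inNbrs G' (v ↑ˡ m) ∣
  ∣∩inNbrs∣-↑ˡ X Y v =
    subst (λ Z → ∣ X ∩ inNbrs G v ∣ ℕ.≤ ∣ Z ∣) (sym split)
          (∣p∣≤∣p++q∣ (X ∩ inNbrs G v) (Y ∩ inNbrs-V₀ v))
    where
    split : (X ++ Y) ∩ inNbrs G' (v ↑ˡ m) ≡ (X ∩ inNbrs G v) ++ (Y ∩ inNbrs-V₀ v)
    split = trans (cong ((X ++ Y) ∩_) (inNbrs-↑ˡ v)) (zipWith-++ _∧_ X Y (inNbrs G v) (inNbrs-V₀ v))

  ∣RN⁺∣-↑ˡ : ∀ ν μ → μ * ⟦ n ℕ.+ m ⟧ ≤ ν * ⟦ n ⟧ →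
             ∀ (X : Subset n) (Y : Subset m) → ∣ RN⁺ ν G X ∣ ℕ.≤ ∣ RN⁺ μ G' (X ++ Y) ∣
  ∣RN⁺∣-↑ˡ ν μ μN'≤νN X Y = ℕ.≤-trans
    (∣tabulate∣-mono λ v v∈RN →
      ≤⇒≤ᵇ (≤-trans μN'≤νN (≤-trans (≤ᵇ⇒≤ v∈RN) (⟦⟧-mono (∣∩inNbrs∣-↑ˡ X Y v)))))
    (∣tabulate∘↑ˡ∣≤∣tabulate∣ n _)

-- RobustOutexpander ν τ H unfolds to ∀ S → RobustlyExpands ν τ H S.
RobustlyExpands : ∀ {N} → ℚ → ℚ → Digraph N → Subset N → Set
RobustlyExpands {N} ν τ H S = τ * ⟦ N ⟧ < ⟦ ∣ S ∣ ⟧ → ⟦ ∣ S ∣ ⟧ < (1ℚ - τ) * ⟦ N ⟧ →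
  ⟦ ∣ S ∣ ⟧ + ν * ⟦ N ⟧ ≤ ⟦ ∣ RN⁺ ν H S ∣ ⟧

∀-++ : ∀ {A : Set} {n m} {P : Vec A (n ℕ.+ m) → Set} → (∀ xs ys → P (xs ++ ys)) → ∀ zs → P zs
∀-++ {n = n} P-++ zs with splitAt n zs
... | xs , ys , refl = P-++ xs ys

robustlyExpands-++ : ∀ {ν τ n m} {G : Digraph n} {G' : Digraph (n ℕ.+ m)} →
  0ℚ ≤ ν → ν ≤ τ → τ ≤ ¼ → RobustOutexpander ν τ G →
  ⟦ m ⟧ ≤ ν * ν * ⟦ n ⟧ → InducesOn G' G →
  ∀ X Y → RobustlyExpands (ν * ½) (⟦ 2 ⟧ * τ) G' (X ++ Y)
robustlyExpands-++ {ν} {τ} {n} {m} {G} {G'} 0≤ν ν≤τ τ≤¼ G-exp m≤ν²n G'-ind X Y lower upper = begin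
  ⟦ ∣ X ++ Y ∣ ⟧ + ν * ½ * ⟦ n ℕ.+ m ⟧  ≡⟨ cong₂ (λ s N′ → s + ν * ½ * N′) (⟦∣p++q∣⟧ X Y) (⟦⟧-+ n m) ⟩
  a + b + ν * ½ * (N + M)              ≤⟨ a+b+ν½[N+M]≤a+νN a 0≤b b≤M ⟩
  a + ν * N                            ≤⟨ G-exp X τN<a a<[1-τ]N ⟩
  ⟦ ∣ RN⁺ ν G X ∣ ⟧                     ≤⟨ ⟦⟧-mono RN⁺-grows ⟩
  ⟦ ∣ RN⁺ (ν * ½) G' (X ++ Y) ∣ ⟧       ∎
  where
  open ≤-Reasoning
  N M a b : ℚ
  N = ⟦ n ⟧
  M = ⟦ m ⟧
  a = ⟦ ∣ X ∣ ⟧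
  b = ⟦ ∣ Y ∣ ⟧
  open FewNewVertices 0≤ν ν≤τ τ≤¼ (0≤⟦⟧ n) m≤ν²n
  0≤b : 0ℚ ≤ b
  0≤b = 0≤⟦⟧ ∣ Y ∣
  b≤M : b ≤ M
  b≤M = ⟦⟧-mono {∣ Y ∣} {m} (∣p∣≤n Y)
  τN<a : τ * N < a
  τN<a = 2τ[N+M]<a+b⇒τN<a a 0≤b b≤M
    (subst₂ (λ N′ s → ⟦ 2 ⟧ * τ * N′ < s) (⟦⟧-+ n m) (⟦∣p++q∣⟧ X Y) lower)
  a<[1-τ]N : a < (1ℚ - τ) * N
  a<[1-τ]N = a+b<[1-2τ][N+M]⇒a<[1-τ]N a 0≤b b≤M
    (subst₂ (λ N′ s → s < (1ℚ - ⟦ 2 ⟧ * τ) * N′) (⟦⟧-+ n m) (⟦∣p++q∣⟧ X Y) upper)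
  RN⁺-grows : ∣ RN⁺ ν G X ∣ ℕ.≤ ∣ RN⁺ (ν * ½) G' (X ++ Y) ∣
  RN⁺-grows = ∣RN⁺∣-↑ˡ {n} {m} {G} {G'} G'-ind ν (ν * ½)
    (subst (λ N′ → ν * ½ * N′ ≤ ν * N) (sym (⟦⟧-+ n m)) ν½[N+M]≤νN) X Y

mainTheorem9 : Σ ℚ (λ τ₀ → 0ℚ < τ₀ ×
    (∀ (ν τ : ℚ) → 0ℚ ≤ ν → ν ≤ τ → τ ≤ τ₀ →
    ∀ (n : ℕ) (G : Digraph n) → RobustOutexpander ν τ G →
    ∀ (m : ℕ) → ⟦ m ⟧ ≤ (ν * ν) * ⟦ n ⟧ →
    ∀ (G' : Digraph (n Data.Nat.+ m)) → InducesOn G' G →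
    RobustOutexpander (ν * ½) (⟦ 2 ⟧ * τ) G'))
mainTheorem9 = ¼ , positive⁻¹ ¼ , λ ν τ 0≤ν ν≤τ τ≤¼ n G G-exp m m≤ν²n G' G'-ind →
  ∀-++ {n = n} {m} {P = RobustlyExpands (ν * ½) (⟦ 2 ⟧ * τ) G'}
    (robustlyExpands-++ {n = n} {m} {G} {G'} 0≤ν ν≤τ τ≤¼ G-exp m≤ν²n G'-ind)
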